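{- For every $w\in\mathcal I_n$, the set of special descents of $w$ equals the set of column descents of $\Phi(w)$.
   Context: $[a,b]=\{i\in\mathbb Z:a\le i\le b\}$. $\mathcal I_n$ is the set of integer sequences $(x_1,\dots,x_n)$ with $0\le x_\ell\le \ell-1$. For $w=(x_1,\dots,x_n)\in\mathcal I_n$ with set of distinct entries $\{y_1<\dots<y_k\}$ and $y_{k+1}:=n$, $\Phi(w)$ is the $k\times k$ matrix whose $(i,j)$ entry is $\{\ell\in[1,n]: x_\ell=y_i\text{ and }y_j<\ell\le y_{j+1}\}$; its non-empty entries partition $[1,n]$. An index $i\in[1,n-1]$ is a special descent of $w$ if $x_i>x_{i+1}$ and $x_\ell\ne i$ for all $\ell\in[1,n]$. For a matrix $A$ whose non-empty entries partition $[1,n]$, let $\mathrm{row}(m)$ and $\mathrm{col}(m)$ be the row and column indices of the entry containing $m$; an index $i\in[1,n-1]$ is a column descent of $A$ if $\mathrm{row}(i)>\mathrm{row}(i+1)$ and $\mathrm{col}(i)=\mathrm{col}(i+1)$. -}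

module Defs where

open import Data.Nat using (ℕ; zero; suc; _≤_; _<_)
open import Data.Nat.Properties using (_≟_)
open import Data.Fin using (Fin; toℕ)
open import Data.Fin.Properties using (any?)
open import Data.List using (List; []; _∷_; filter; upTo; length)
open import Data.Product using (Σ; _×_)
open import Relation.Binary.PropositionalEquality using (_≡_; _≢_)
open import Relation.Nullary using (Dec)

-- 𝓘_n : sequences (x_1,…,x_n) with 0 ≤ x_ℓ ≤ ℓ-1.
-- Position ℓ ∈ [1,n] is represented by p : Fin n with ℓ = suc (toℕ p),
-- so the constraint x_ℓ ≤ ℓ - 1 reads  x p ≤ toℕ p.
record InvSeq (n : ℕ) : Set where
  field
    x     : Fin n → ℕ
    bound : ∀ p → x p ≤ toℕ p
open InvSeq public

EntryAt : ∀ {n} → InvSeq n → ℕ → ℕ → Set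
EntryAt {n} w ℓ v = Σ (Fin n) λ p → (suc (toℕ p) ≡ ℓ) × (x w p ≡ v)

Occurs : ∀ {n} → InvSeq n → ℕ → Set
Occurs {n} w v = Σ (Fin n) λ p → x w p ≡ v

occurs? : ∀ {n} (w : InvSeq n) (v : ℕ) → Dec (Occurs w v)
occurs? w v = any? (λ p → x w p ≟ v)

-- the distinct entries y_1 < … < y_k, listed increasingly
-- (all entries lie in [0, n-1], so filtering upTo n = [0,…,n-1] suffices)
distinctVals : ∀ {n} → InvSeq n → List ℕ
distinctVals {n} w = filter (occurs? w) (upTo n)

nDistinct : ∀ {n} → InvSeq n → ℕ
nDistinct w = length (distinctVals w)

nthOr : List ℕ → ℕ → ℕ → ℕ
nthOr []       _       d = d
nthOr (a ∷ as) zero    d = a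
nthOr (a ∷ as) (suc j) d = nthOr as j d

-- y_{j+1} (0-indexed j), with y_{k+1} := n  (index k gives the default n)
yv : ∀ {n} → InvSeq n → ℕ → ℕ
yv {n} w j = nthOr (distinctVals w) j n

Mat : ℕ → Set₁
Mat k = Fin k → Fin k → ℕ → Set

Φ : ∀ {n} (w : InvSeq n) → Mat (nDistinct w)
Φ {n} w i j ℓ =
  (1 ≤ ℓ) × (ℓ ≤ n) × EntryAt w ℓ (yv w (toℕ i))
  × (yv w (toℕ j) < ℓ) × (ℓ ≤ yv w (suc (toℕ j)))

SpecialDescent : ∀ {n} → InvSeq n → ℕ → Set
SpecialDescent {n} w i =
  (1 ≤ i) × (suc i ≤ n)
  × (Σ ℕ λ a → Σ ℕ λ b → EntryAt w i a × EntryAt w (suc i) b × b < a)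
  × (∀ (p : Fin n) → x w p ≢ i)

-- column descent i ∈ [1,n-1] of a matrix A whose nonempty entries
-- partition [1,n]: row(i) > row(i+1) and col(i) = col(i+1).
-- (row(m), col(m)) is the (unique, by the partition property) position
-- (r,c) with m ∈ A r c.
ColumnDescent : ∀ {k} → ℕ → Mat k → ℕ → Set
ColumnDescent {k} n A i =
  (1 ≤ i) × (suc i ≤ n)
  × (Σ (Fin k) λ r₁ → Σ (Fin k) λ c₁ → Σ (Fin k) λ r₂ → Σ (Fin k) λ c₂ →
       A r₁ c₁ i × A r₂ c₂ (suc i) × (toℕ r₂ < toℕ r₁) × (c₁ ≡ c₂))

module Submission where

-- Because the y's increase strictly, comparing
-- rows is the same as comparing values, so row(i) > row(i+1) says exactly
-- x_i > x_{i+1}.  The columns are the half-open intervals cut out by the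
-- values together with n, so i and i+1 share a column iff no cut point equals
-- i; as i < n, this means that i is not an entry of w.

open import Defs
open import Data.Nat using (ℕ; zero; suc; _≤_; _<_; z≤n; s≤s; s≤s⁻¹; _≤?_)
open import Data.Nat.Properties
open import Data.Fin using (Fin; toℕ; fromℕ<) renaming (zero to fzero; suc to fsuc)
open import Data.Fin.Properties using (toℕ<n; toℕ-fromℕ<)
open import Data.List using (List; []; _∷_; length; upTo)
open import Data.List.Relation.Unary.All using (All; []; _∷_; lookup)
open import Data.List.Relation.Unary.Any using (here; there)
open import Data.List.Relation.Unary.AllPairs using (AllPairs; []; _∷_)
import Data.List.Relation.Unary.AllPairs.Properties as AllPairs
import Data.List.Relation.Unary.All.Properties as All
open import Data.List.Membership.Propositional using (_∈_; _∉_)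
open import Data.List.Membership.Propositional.Properties using (∈-filter⁺; ∈-filter⁻; ∈-upTo⁺)
open import Data.Product using (Σ; _×_; _,_; proj₂)
open import Data.Sum using (_⊎_; inj₁; inj₂)
open import Data.Empty using (⊥; ⊥-elim)
open import Relation.Nullary using (yes; no)
open import Relation.Binary using (tri<; tri≈; tri>)
open import Relation.Binary.PropositionalEquality using (_≡_; _≢_; refl; sym; trans; subst; subst₂; ≢-sym)
open import Function.Bundles using (_⇔_; mk⇔)

nthOr-lowerBound : ∀ {a d} (L : List ℕ) → All (a <_) L → a < d →
  ∀ j → a < nthOr L j d
nthOr-lowerBound []      _        a<d j       = a<d
nthOr-lowerBound (b ∷ L) (a<b ∷ _) a<d zero    = a<b
nthOr-lowerBound (b ∷ L) (_ ∷ a<L) a<d (suc j) = nthOr-lowerBound L a<L a<d j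

nthOr-strictMono : ∀ {d} (L : List ℕ) → AllPairs _<_ L → All (_< d) L →
  ∀ j j' → j < length L → j < j' → nthOr L j d < nthOr L j' d
nthOr-strictMono (a ∷ L) (a<L ∷ _) (a<d ∷ _) zero (suc j') _ _ = nthOr-lowerBound L a<L a<d j'
nthOr-strictMono (a ∷ L) (_ ∷ sorted) (_ ∷ bounded) (suc j) (suc j') (s≤s j<len) (s≤s j<j') =
  nthOr-strictMono L sorted bounded j j' j<len j<j'

nthOr-memberOrDefault : ∀ (L : List ℕ) j d → (nthOr L j d ∈ L) ⊎ (nthOr L j d ≡ d)
nthOr-memberOrDefault []      j       d = inj₂ refl
nthOr-memberOrDefault (a ∷ L) zero    d = inj₁ (here refl)
nthOr-memberOrDefault (a ∷ L) (suc j) d with nthOr-memberOrDefault L j d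
... | inj₁ v∈L = inj₁ (there v∈L)
... | inj₂ v≡d = inj₂ v≡d

nthOr-avoids : ∀ {v d} (L : List ℕ) → v ∉ L → v ≢ d → ∀ j → nthOr L j d ≢ v
nthOr-avoids L v∉L v≢d j t≡v with nthOr-memberOrDefault L j _
... | inj₁ t∈L = v∉L (subst (_∈ L) t≡v t∈L)
... | inj₂ t≡d = v≢d (trans (sym t≡v) t≡d)

nthOr-index : ∀ {v d} (L : List ℕ) → v ∈ L →
  Σ (Fin (length L)) λ r → nthOr L (toℕ r) d ≡ v
nthOr-index (a ∷ L) (here refl) = fzero , refl
nthOr-index (a ∷ L) (there v∈L) with nthOr-index L v∈L
... | r , t≡v = fsuc r , t≡v

nthOr-locate : ∀ {ℓ d} a (L : List ℕ) → a < ℓ → ℓ ≤ d →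
  Σ (Fin (length (a ∷ L))) λ c →
    nthOr (a ∷ L) (toℕ c) d < ℓ × ℓ ≤ nthOr (a ∷ L) (suc (toℕ c)) d
nthOr-locate a []      a<ℓ ℓ≤d = fzero , a<ℓ , ℓ≤d
nthOr-locate {ℓ} a (b ∷ L) a<ℓ ℓ≤d with ℓ ≤? b
... | yes ℓ≤b = fzero , a<ℓ , ℓ≤b
... | no  ℓ≰b with nthOr-locate b L (≰⇒> ℓ≰b) ℓ≤d
...   | c , below , above = fsuc c , below , above

head-≤-member : ∀ {a v} (L : List ℕ) → AllPairs _<_ (a ∷ L) → v ∈ (a ∷ L) → a ≤ v
head-≤-member L _           (here refl)  = ≤-refl
head-≤-member L (a<L ∷ _) (there v∈L) = <⇒≤ (lookup a<L v∈L)

module SortedTerms {d : ℕ} (L : List ℕ)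
                   (sorted : AllPairs _<_ L) (bounded : All (_< d) L) where

  term : ℕ → ℕ
  term j = nthOr L j d

  term-strictMono : ∀ j j' → j < length L → j < j' → term j < term j'
  term-strictMono = nthOr-strictMono L sorted bounded

  term-reflects-< : ∀ j j' → j < length L → term j < term j' → j < j'
  term-reflects-< j j' j<len t<t' with <-cmp j j'
  ... | tri< j<j' _ _ = j<j'
  ... | tri≈ _ refl _ = ⊥-elim (<-irrefl refl t<t')
  ... | tri> _ _ j'<j =
    ⊥-elim (<-asym t<t' (term-strictMono j' j (<-trans j'<j j<len) j'<j))

  no-member-in-gap : ∀ {v} c → c < length L → v ∈ L → term c < v → v < term (suc c) → ⊥
  no-member-in-gap c c<len v∈L t<v v<t' with nthOr-index {d = d} L v∈L
  ... | m , tm≡v = <-irrefl refl (<-≤-trans c<m m≤c)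
    where
    c<m : c < toℕ m
    c<m = term-reflects-< c (toℕ m) c<len (subst (term c <_) (sym tm≡v) t<v)
    m≤c : toℕ m ≤ c
    m≤c = s≤s⁻¹ (term-reflects-< (toℕ m) (suc c) (toℕ<n m)
                  (subst (_< term (suc c)) (sym tm≡v) v<t'))

locate-positive : ∀ {ℓ d} (L : List ℕ) → AllPairs _<_ L → 0 ∈ L → 0 < ℓ → ℓ ≤ d →
  Σ (Fin (length L)) λ c → nthOr L (toℕ c) d < ℓ × ℓ ≤ nthOr L (suc (toℕ c)) d
locate-positive (a ∷ L) sorted 0∈L 0<ℓ ℓ≤d =
  nthOr-locate a L (≤-<-trans (head-≤-member L sorted 0∈L) 0<ℓ) ℓ≤d

module DistinctEntries {n : ℕ} (w : InvSeq n) where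

  values : List ℕ
  values = distinctVals w

  sorted : AllPairs _<_ values
  sorted = AllPairs.filter⁺ (occurs? w) (AllPairs.applyUpTo⁺₁ (λ v → v) n (λ v<v' _ → v<v'))

  bounded : All (_< n) values
  bounded = All.filter⁺ (occurs? w) (All.all-upTo n)

  open SortedTerms values sorted bounded

  occurs⇒∈ : ∀ {v} → Occurs w v → v ∈ values
  occurs⇒∈ (p , xp≡v) = ∈-filter⁺ (occurs? w)
    (∈-upTo⁺ (subst (_< n) xp≡v (≤-<-trans (bound w p) (toℕ<n p)))) (p , xp≡v)

  ∈⇒occurs : ∀ {v} → v ∈ values → Occurs w v
  ∈⇒occurs v∈ = proj₂ (∈-filter⁻ (occurs? w) {xs = upTo n} v∈)

  -- x_1 = 0 is forced, so 0 is an entry as soon as w is non-empty.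
  zero∈values : 0 < n → 0 ∈ values
  zero∈values 0<n = occurs⇒∈ (first , n≤0⇒n≡0 x₁≤0)
    where
    first : Fin n
    first = fromℕ< 0<n
    x₁≤0 : x w first ≤ 0
    x₁≤0 = subst (x w first ≤_) (toℕ-fromℕ< 0<n) (bound w first)

  rowOf : ∀ {ℓ v} → EntryAt w ℓ v → Σ (Fin (nDistinct w)) λ r → yv w (toℕ r) ≡ v
  rowOf (p , _ , xp≡v) = nthOr-index values (occurs⇒∈ (p , xp≡v))

  columnOf : ∀ {ℓ} → 1 ≤ ℓ → ℓ ≤ n →
    Σ (Fin (nDistinct w)) λ c → yv w (toℕ c) < ℓ × ℓ ≤ yv w (suc (toℕ c))
  columnOf 1≤ℓ ℓ≤n = locate-positive values sorted (zero∈values (<-≤-trans 1≤ℓ ℓ≤n)) 1≤ℓ ℓ≤n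

  -- A special descent i is in the same column as i+1: the right end of the
  -- column of i is an entry or n, and i is neither.
  special⇒column : ∀ i → SpecialDescent w i → ColumnDescent n (Φ w) i
  special⇒column i (1≤i , i<n , (a , b , Eᵢ , Eᵢ₊₁ , b<a) , fresh)
    with rowOf Eᵢ | rowOf Eᵢ₊₁ | columnOf 1≤i (<⇒≤ i<n)
  ... | r₁ , y≡a | r₂ , y≡b | c , below , above =
    1≤i , i<n , r₁ , c , r₂ , c ,
    (1≤i , <⇒≤ i<n , subst (EntryAt w i) (sym y≡a) Eᵢ , below , above) ,
    (s≤s z≤n , i<n , subst (EntryAt w (suc i)) (sym y≡b) Eᵢ₊₁ ,
       m<n⇒m<1+n below , ≤∧≢⇒< above (≢-sym (nthOr-avoids values i∉values (<⇒≢ i<n) _))) ,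
    term-reflects-< (toℕ r₂) (toℕ r₁) (toℕ<n r₂) (subst₂ _<_ (sym y≡b) (sym y≡a) b<a) ,
    refl
    where
    i∉values : i ∉ values
    i∉values i∈ with ∈⇒occurs i∈
    ... | p , xp≡i = fresh p xp≡i

  -- A column descent i is a special descent: the rows give x_i > x_{i+1}, and
  -- an entry equal to i would lie strictly inside the common column.
  column⇒special : ∀ i → ColumnDescent n (Φ w) i → SpecialDescent w i
  column⇒special i (1≤i , i<n , r₁ , c , r₂ , .c ,
                    (_ , _ , Eᵢ , below , _) , (_ , _ , Eᵢ₊₁ , _ , above) , r₂<r₁ , refl) =
    1≤i , i<n ,
    (yv w (toℕ r₁) , yv w (toℕ r₂) , Eᵢ , Eᵢ₊₁ ,
       term-strictMono (toℕ r₂) (toℕ r₁) (toℕ<n r₂) r₂<r₁) ,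
    λ p xp≡i → no-member-in-gap (toℕ c) (toℕ<n c) (occurs⇒∈ (p , xp≡i)) below above

proposition6 : (n : ℕ) (w : InvSeq n) (i : ℕ) →
    SpecialDescent w i ⇔ ColumnDescent n (Φ w) i
proposition6 n w i = mk⇔ (special⇒column i) (column⇒special i)
  where open DistinctEntries w
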